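{- For even $n\geq 2$, let $\mathrm{Dic}_n=\langle a,b,c\mid a^n=b^2=c^2=abc\rangle$ be the dicyclic group of order $4n$. Then Player 2 has a winning strategy for $\texttt{REL}(\mathrm{Dic}_n,\{a,b,c\})$.
   Context: Game $\texttt{REL}(G,S)$: $G$ is a finite group and $S$ a generating set with $e\notin S$. Two players alternate turns, Player 1 first, starting from the empty word $w_0$. On turn $n$ the current player chooses $s_n\in S\cup S^{ -1}$, subject to $s_n\neq s_{n-1}^{ -1}$ when $n>1$, and forms $w_n=w_{n-1}s_n$. If $w_n$ represents the same element of $G$ as some $w_k$ with $0\le k<n$, the player who formed $w_n$ wins. If a player has no legal move, that player loses. -}

module Defs where

open import Data.Nat using (ℕ; zero; suc; _+_; _∸_; NonZero)
open import Data.Nat.DivMod using (_mod_)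
open import Data.Fin using (Fin; toℕ)
open import Data.Bool using (Bool; true; false)
open import Data.Product using (_×_; _,_)
open import Data.Maybe using (Maybe; just; nothing)
open import Data.List using (List; []; _∷_)
open import Data.List.Membership.Propositional using (_∈_; _∉_)
open import Relation.Binary.PropositionalEquality using (_≢_)

-- The game REL(G,S), for a group given by its multiplication _·_ and
-- inversion inv, and the list `moves` enumerating S ∪ S⁻¹ (as group
-- elements).  A position records: the list `vis` of group elements
-- represented by w_0, …, w_{n-1} (w_0 = e), the element `cur`
-- represented by the current word, and the last letter played (if any).
--
-- Wins  vis cur last : the player about to move has a winning strategy.
-- Loses vis cur last : the player about to move has no way to avoid
--                      losing, i.e. the *other* player has a winning
--                      strategy.  (The game is finite, so well-founded
--                      strategy trees capture winning strategies.)

module REL {A : Set} (_·_ : A → A → A) (inv : A → A) (moves : List A) where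

  Legal : Maybe A → A → Set
  Legal nothing  s = s ∈ moves
  Legal (just p) s = (s ∈ moves) × (s ≢ inv p)

  data Wins  (vis : List A) (cur : A) (last : Maybe A) : Set
  data Loses (vis : List A) (cur : A) (last : Maybe A) : Set

  data Wins vis cur last where
    -- the move closes a relation: the mover wins immediately
    winNow   : (s : A) → Legal last s → (cur · s) ∈ vis → Wins vis cur last
    winLater : (s : A) → Legal last s → (cur · s) ∉ vis →
               Loses ((cur · s) ∷ vis) (cur · s) (just s) → Wins vis cur last

  data Loses vis cur last where
    -- every legal move reaches a new element from which the opponent wins
    -- (in particular, a player with no legal move loses)
    loses : ((s : A) → Legal last s →
               ((cur · s) ∉ vis) × Wins ((cur · s) ∷ vis) (cur · s) (just s)) →
            Loses vis cur last

  Player2Wins : A → Set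
  Player2Wins e = Loses (e ∷ []) e nothing

-- The dicyclic group Dic_n = ⟨a,b,c | a^n = b^2 = c^2 = abc⟩ of order 4n,
-- realised concretely: (k , false) stands for a^k and (k , true) for
-- a^k b, with k ∈ ℤ/2n.  Relations: a^{2n} = e, b^2 = a^n, b a b⁻¹ = a⁻¹,
-- and c = ab (forced by abc = b^2).

module Dicyclic (n : ℕ) .{{_ : NonZero n}} where

  N : ℕ
  N = n + n

  private
    nzN : (m : ℕ) → .{{NonZero m}} → NonZero (m + m)
    nzN (suc m) = _

  instance
    NonZero-N : NonZero N
    NonZero-N = nzN n

  Dic : Set
  Dic = Fin N × Bool

  md : ℕ → Fin N
  md k = k mod N

  infixl 7 _·_
  _·_ : Dic → Dic → Dic
  (k , false) · (m , j)     = md (toℕ k + toℕ m) , j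
  (k , true)  · (m , false) = md (toℕ k + (N ∸ toℕ m)) , true
  (k , true)  · (m , true)  = md (toℕ k + (N ∸ toℕ m) + n) , false

  inv : Dic → Dic
  inv (k , false) = md (N ∸ toℕ k) , false
  inv (k , true)  = md (toℕ k + n) , true

  e a b c : Dic
  e = md 0 , false
  a = md 1 , false
  b = md 0 , true
  c = md 1 , true

  moves : List Dic
  moves = a ∷ b ∷ c ∷ inv a ∷ inv b ∷ inv c ∷ []

  open REL _·_ inv moves public

-- Let H = ⟨a²⟩. For even n it is normal with Dic_n / H ≅ ℤ/2 × ℤ/2, and the three non-trivial
-- cosets contain exactly a^{±1}, b^{±1} and c^{±1} respectively. Player 2 answers every letter s
-- with s again; as s² ∈ H, Player 1 always moves from an element of H. Player 2 keeps the
-- invariant that every element of H one letter away from a visited element is itself visited: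
-- hs is reached from H only by s from h and by s⁻¹ from hs², both visited once hs is. Hence
-- Player 1 never closes a relation, and since the game is finite, Player 2 eventually does.

module Submission where

open import Defs
open import Data.Nat using (ℕ; suc; _+_; _*_; _∸_; _≤_; _<_; NonZero; z≤n; s≤s; >-nonZero; ≢-nonZero⁻¹; parity)
open import Data.Nat.Properties
  using ( +-assoc; +-comm; +-commutativeSemigroup; m∸n+n≡m; <⇒≤; ≤-trans; +-mono-≤; +-monoˡ-<; m<m+n
        ; ∸-monoʳ-<; <⇒≢; suc-injective; m≤n⇒m≤1+n)
open import Data.Nat.DivMod using (_%_; _/_; m%n<n; m<n⇒m%n≡m; %-distribˡ-+; [m+n]%n≡m%n; m≡m%n+[m/n]*n)
open import Data.Nat.Divisibility using (_∣_; divides)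
open import Data.Nat.Induction using (<-wellFounded)
open import Data.Parity using (Parity; 0ℙ)
import Data.Parity as ℙ
import Data.Parity.Properties as ℙ
open import Data.Fin using (toℕ)
import Data.Fin.Properties as Fin
open import Data.Bool using (Bool; true; false; _xor_)
import Data.Bool.Properties as Bool
open import Data.Product using (_×_; _,_; proj₁; ∃-syntax)
open import Data.Product.Properties using (≡-dec)
open import Data.Sum using (_⊎_; inj₁; inj₂)
open import Data.Maybe using (Maybe; just; nothing)
open import Data.List using (List; []; _∷_; allFin; cartesianProduct)
open import Data.List.Relation.Unary.Any using (here; there)
open import Data.List.Membership.Propositional using (_∈_; _∉_)
open import Data.List.Membership.Propositional.Properties using (∈-++⁻; ∈-map⁻; ∈-allFin; ∈-cartesianProduct⁺)
open import Data.List.Relation.Binary.Subset.Propositional using (_⊆_)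
open import Algebra.Properties.CommutativeSemigroup +-commutativeSemigroup using (xy∙z≈xz∙y; x∙yz≈zx∙y; interchange)
open import Induction.WellFounded using (Acc; acc)
open import Relation.Binary.Definitions using (DecidableEquality)
open import Relation.Binary.PropositionalEquality using (_≡_; _≢_; refl; sym; trans; cong; cong₂; subst; module ≡-Reasoning)
open import Relation.Nullary using (yes; no; contradiction)

module _ {A : Set} (_≟_ : DecidableEquality A) where

  open import Data.List.Membership.DecPropositional _≟_ using (_∈?_)

  unvisited : List A → List A → ℕ
  unvisited []       V = 0
  unvisited (x ∷ xs) V with x ∈? V
  ... | yes _ = unvisited xs V
  ... | no  _ = suc (unvisited xs V)

  unvisited-mono : ∀ xs {V V′} → V ⊆ V′ → unvisited xs V′ ≤ unvisited xs V
  unvisited-mono []       V⊆V′ = z≤n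
  unvisited-mono (x ∷ xs) {V} {V′} V⊆V′ with x ∈? V | x ∈? V′
  ... | yes _   | yes _    = unvisited-mono xs V⊆V′
  ... | yes x∈V | no  x∉V′ = contradiction (V⊆V′ x∈V) x∉V′
  ... | no  _   | yes _    = m≤n⇒m≤1+n (unvisited-mono xs V⊆V′)
  ... | no  _   | no  _    = s≤s (unvisited-mono xs V⊆V′)

  unvisited-strict : ∀ xs {V V′ v} → V ⊆ V′ → v ∈ xs → v ∉ V → v ∈ V′ →
                     unvisited xs V′ < unvisited xs V
  unvisited-strict (x ∷ xs) {V} {V′} V⊆V′ (here refl) v∉V v∈V′ with x ∈? V | x ∈? V′
  ... | yes x∈V | _        = contradiction x∈V v∉V
  ... | no  _   | no  x∉V′ = contradiction v∈V′ x∉V′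
  ... | no  _   | yes _    = s≤s (unvisited-mono xs V⊆V′)
  unvisited-strict (x ∷ xs) {V} {V′} V⊆V′ (there v∈xs) v∉V v∈V′ with x ∈? V | x ∈? V′
  ... | yes _   | yes _    = unvisited-strict xs V⊆V′ v∈xs v∉V v∈V′
  ... | yes x∈V | no  x∉V′ = contradiction (V⊆V′ x∈V) x∉V′
  ... | no  _   | yes _    = m≤n⇒m≤1+n (unvisited-strict xs V⊆V′ v∈xs v∉V v∈V′)
  ... | no  _   | no  _    = s≤s (unvisited-strict xs V⊆V′ v∈xs v∉V v∈V′)

-- Player 2 repeats every letter of Player 1; Home holds the positions from which Player 1 moves.
module RepeatingStrategy
  {A : Set} (_·_ : A → A → A) (inv : A → A) (moves : List A)
  (_≟_ : DecidableEquality A) (elements : List A) (∈-elements : ∀ x → x ∈ elements)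
  (Home : A → Set)
  (home-closed : ∀ {x s} → Home x → s ∈ moves → Home ((x · s) · s))
  (home-apart : ∀ {x y u} → Home x → Home y → u ∈ moves → x · u ≢ y)
  (home-neighbours : ∀ {x y s u} → Home x → Home y → s ∈ moves → u ∈ moves →
                     x · s ≡ y · u → y ≡ x ⊎ (y ≡ (x · s) · s × u ≡ inv s))
  (≢-inv : ∀ {s} → s ∈ moves → s ≢ inv s)
  where

  open REL _·_ inv moves
  open import Data.List.Membership.DecPropositional _≟_ using (_∈?_)

  HomeClosed : List A → Set
  HomeClosed V = ∀ {y u} → Home y → u ∈ moves → y · u ∈ V → y ∈ V

  NoClosingMove : List A → A → Maybe A → Set
  NoClosingMove V x last = ∀ u → Legal last u → x · u ∉ V

  legal⇒∈ : ∀ last {s} → Legal last s → s ∈ moves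
  legal⇒∈ nothing  s∈ = s∈
  legal⇒∈ (just _) (s∈ , _) = s∈

  module _ {V x s} (hx : Home x) (x∈V : x ∈ V) (s∈ : s ∈ moves) (closed : HomeClosed V) where

    private
      v w : A
      v = x · s
      w = v · s

    homeClosed-∷ : HomeClosed (w ∷ v ∷ V)
    homeClosed-∷ hy u∈ (here eq) = contradiction eq (home-apart hy (home-closed hx s∈) u∈)
    homeClosed-∷ hy u∈ (there (here eq)) with home-neighbours hx hy s∈ u∈ (sym eq)
    ... | inj₁ refl       = there (there x∈V)
    ... | inj₂ (refl , _) = here refl
    homeClosed-∷ hy u∈ (there (there yu∈V)) = there (there (closed hy u∈ yu∈V))

    noClosingMove-∷ : w ∉ V → NoClosingMove (w ∷ v ∷ V) w (just s)
    noClosingMove-∷ w∉V u (u∈ , _) (here eq) = home-apart hw hw u∈ eq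
      where hw = home-closed hx s∈
    noClosingMove-∷ w∉V u (u∈ , u≢s⁻¹) (there (here eq))
      with home-neighbours hx (home-closed hx s∈) s∈ u∈ (sym eq)
    ... | inj₁ w≡x         = w∉V (subst (_∈ V) (sym w≡x) x∈V)
    ... | inj₂ (_ , u≡s⁻¹) = u≢s⁻¹ u≡s⁻¹
    noClosingMove-∷ w∉V u (u∈ , _) (there (there wu∈V)) = w∉V (closed (home-closed hx s∈) u∈ wu∈V)

  player1-loses : ∀ {V x last} → Acc _<_ (unvisited _≟_ elements V) →
                  Home x → x ∈ V → HomeClosed V → NoClosingMove V x last → Loses V x last
  player1-loses {V} {x} {last} (acc rec) hx x∈V closed no-close =
    loses λ s legal → no-close s legal , reply s (legal⇒∈ last legal) (no-close s legal)
    where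
      reply : ∀ s → s ∈ moves → x · s ∉ V → Wins ((x · s) ∷ V) (x · s) (just s)
      reply s s∈ v∉V with (x · s) · s ∈? ((x · s) ∷ V)
      ... | yes w∈ = winNow s (s∈ , ≢-inv s∈) w∈
      ... | no  w∉ = winLater s (s∈ , ≢-inv s∈) w∉
        (player1-loses (rec fewer) (home-closed hx s∈) (here refl)
          (homeClosed-∷ hx x∈V s∈ closed) (noClosingMove-∷ hx x∈V s∈ closed (λ w∈V → w∉ (there w∈V))))
        where
          fewer = unvisited-strict _≟_ elements (λ y∈V → there (there y∈V))
                    (∈-elements (x · s)) v∉V (there (here refl))

  player2-wins : ∀ {e} → Home e → Player2Wins e
  player2-wins he = player1-loses (<-wellFounded _) he (here refl) start-closed start-safe
    where
      start-closed : HomeClosed (_ ∷ [])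
      start-closed hy u∈ (here eq) = contradiction eq (home-apart hy he u∈)
      start-safe : NoClosingMove (_ ∷ []) _ nothing
      start-safe u u∈ (here eq) = home-apart he he u∈ eq

even⇒parity≡0ℙ : ∀ {m} → 2 ∣ m → parity m ≡ 0ℙ
even⇒parity≡0ℙ (divides q refl) = trans (ℙ.*-homo-* q 2) (ℙ.*-zeroʳ (parity q))

Klein : Set
Klein = Parity × Bool

0ᴷ : Klein
0ᴷ = 0ℙ , false

infixl 6 _⊕_
_⊕_ : Klein → Klein → Klein
(p , β) ⊕ (q , γ) = p ℙ.+ q , β xor γ

⊕-cancelʳ : ∀ c d → c ⊕ d ⊕ d ≡ c
⊕-cancelʳ (p , β) (q , γ) = cong₂ _,_
  (trans (ℙ.+-assoc p q q) (trans (cong (p ℙ.+_) (ℙ.p+p≡0ℙ q)) (ℙ.+-identityʳ p)))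
  (trans (Bool.xor-assoc β γ γ) (trans (cong (β xor_) (Bool.xor-same γ)) (Bool.xor-identityʳ β)))

module DicyclicProperties (n : ℕ) .{{_ : NonZero n}} where

  open Dicyclic n

  _≟_ : DecidableEquality Dic
  _≟_ = ≡-dec Fin._≟_ Bool._≟_

  elements : List Dic
  elements = cartesianProduct (allFin N) (false ∷ true ∷ [])

  ∈-elements : ∀ x → x ∈ elements
  ∈-elements (k , false) = ∈-cartesianProduct⁺ (∈-allFin k) (here refl)
  ∈-elements (k , true)  = ∈-cartesianProduct⁺ (∈-allFin k) (there (here refl))

  toℕ-md : ∀ x → toℕ (md x) ≡ x % N
  toℕ-md x = Fin.toℕ-fromℕ< (m%n<n x N)

  %≡⇒md≡ : ∀ {x y} → x % N ≡ y % N → md x ≡ md y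
  %≡⇒md≡ {x} {y} eq = Fin.toℕ-injective (trans (toℕ-md x) (trans eq (sym (toℕ-md y))))

  md≡⇒%≡ : ∀ {x y} → md x ≡ md y → x % N ≡ y % N
  md≡⇒%≡ {x} {y} eq = trans (sym (toℕ-md x)) (trans (cong toℕ eq) (toℕ-md y))

  md-injective : ∀ {x y} → x < N → y < N → md x ≡ md y → x ≡ y
  md-injective x<N y<N eq = trans (sym (m<n⇒m%n≡m x<N)) (trans (md≡⇒%≡ eq) (m<n⇒m%n≡m y<N))

  md-toℕ : ∀ k → md (toℕ k) ≡ k
  md-toℕ k = Fin.toℕ-injective (trans (toℕ-md (toℕ k)) (m<n⇒m%n≡m (Fin.toℕ<n k)))

  md-+N : ∀ x → md (x + N) ≡ md x
  md-+N x = %≡⇒md≡ ([m+n]%n≡m%n x N)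

  md-+-congʳ : ∀ {x x′} y → md x ≡ md x′ → md (x + y) ≡ md (x′ + y)
  md-+-congʳ {x} {x′} y eq = %≡⇒md≡ (begin
    (x + y) % N             ≡⟨ %-distribˡ-+ x y N ⟩
    (x % N + y % N) % N     ≡⟨ cong (λ t → (t + y % N) % N) (md≡⇒%≡ eq) ⟩
    (x′ % N + y % N) % N    ≡⟨ %-distribˡ-+ x′ y N ⟨
    (x′ + y) % N            ∎)
    where open ≡-Reasoning

  md-+-congˡ : ∀ x {y y′} → md y ≡ md y′ → md (x + y) ≡ md (x + y′)
  md-+-congˡ x {y} {y′} eq rewrite +-comm x y | +-comm x y′ = md-+-congʳ x eq

  md-∸-cancel : ∀ x {y} → y ≤ N → md (x + (N ∸ y) + y) ≡ md x
  md-∸-cancel x {y} y≤N = trans (cong md (trans (+-assoc x (N ∸ y) y) (cong (x +_) (m∸n+n≡m y≤N)))) (md-+N x)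

  md-neg-cancel : ∀ x y → md (x + (N ∸ toℕ (md y)) + y) ≡ md x
  md-neg-cancel x y = trans (md-+-congˡ (x + (N ∸ toℕ (md y))) (sym (md-toℕ (md y))))
                            (md-∸-cancel x (<⇒≤ (Fin.toℕ<n (md y))))

  ·-inverseʳ : ∀ x y → (x · y) · inv y ≡ x
  ·-inverseʳ (k , false) (m , false) = cong (_, false) (begin
    md (toℕ (md (K + M)) + toℕ (md (N ∸ M))) ≡⟨ md-+-congʳ _ (md-toℕ _) ⟩
    md (K + M + toℕ (md (N ∸ M)))             ≡⟨ md-+-congˡ (K + M) (md-toℕ _) ⟩
    md (K + M + (N ∸ M))                      ≡⟨ cong md (xy∙z≈xz∙y K M (N ∸ M)) ⟩
    md (K + (N ∸ M) + M)                      ≡⟨ md-∸-cancel K (<⇒≤ (Fin.toℕ<n m)) ⟩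
    md K                                      ≡⟨ md-toℕ k ⟩
    k                                         ∎)
    where open ≡-Reasoning; K = toℕ k; M = toℕ m
  ·-inverseʳ (k , false) (m , true) = cong (_, false) (begin
    md (toℕ (md (K + M)) + (N ∸ Z) + n) ≡⟨ md-+-congʳ n (md-+-congʳ (N ∸ Z) (md-toℕ _)) ⟩
    md (K + M + (N ∸ Z) + n)            ≡⟨ cong (λ t → md (t + n)) (xy∙z≈xz∙y K M (N ∸ Z)) ⟩
    md (K + (N ∸ Z) + M + n)            ≡⟨ cong md (+-assoc (K + (N ∸ Z)) M n) ⟩
    md (K + (N ∸ Z) + (M + n))          ≡⟨ md-neg-cancel K (M + n) ⟩
    md K                                ≡⟨ md-toℕ k ⟩
    k                                   ∎)
    where open ≡-Reasoning; K = toℕ k; M = toℕ m; Z = toℕ (md (M + n))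
  ·-inverseʳ (k , true) (m , false) = cong (_, true) (begin
    md (toℕ (md (K + (N ∸ M))) + (N ∸ Z)) ≡⟨ md-+-congʳ (N ∸ Z) (md-toℕ _) ⟩
    md (K + (N ∸ M) + (N ∸ Z))            ≡⟨ cong md (xy∙z≈xz∙y K (N ∸ M) (N ∸ Z)) ⟩
    md (K + (N ∸ Z) + (N ∸ M))            ≡⟨ md-neg-cancel K (N ∸ M) ⟩
    md K                                  ≡⟨ md-toℕ k ⟩
    k                                     ∎)
    where open ≡-Reasoning; K = toℕ k; M = toℕ m; Z = toℕ (md (N ∸ M))
  ·-inverseʳ (k , true) (m , true) = cong (_, true) (begin
    md (toℕ (md (K + (N ∸ M) + n)) + toℕ (md (M + n))) ≡⟨ md-+-congʳ _ (md-toℕ _) ⟩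
    md (K + (N ∸ M) + n + toℕ (md (M + n)))            ≡⟨ md-+-congˡ (K + (N ∸ M) + n) (md-toℕ _) ⟩
    md (K + (N ∸ M) + n + (M + n))                     ≡⟨ cong md (interchange (K + (N ∸ M)) n M n) ⟩
    md (K + (N ∸ M) + M + N)                           ≡⟨ md-+N _ ⟩
    md (K + (N ∸ M) + M)                               ≡⟨ md-∸-cancel K (<⇒≤ (Fin.toℕ<n m)) ⟩
    md K                                               ≡⟨ md-toℕ k ⟩
    k                                                  ∎)
    where open ≡-Reasoning; K = toℕ k; M = toℕ m

  ·-cancelʳ : ∀ s x y → x · s ≡ y · s → x ≡ y
  ·-cancelʳ s x y eq = trans (sym (·-inverseʳ x s)) (trans (cong (_· inv s) eq) (·-inverseʳ y s))

  inv-involutive : ∀ x → inv (inv x) ≡ x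
  inv-involutive (k , false) = cong (_, false) (begin
    md (N ∸ Z)                       ≡⟨ md-+N (N ∸ Z) ⟨
    md ((N ∸ Z) + N)                 ≡⟨ cong (λ t → md ((N ∸ Z) + t)) (m∸n+n≡m (<⇒≤ (Fin.toℕ<n k))) ⟨
    md ((N ∸ Z) + ((N ∸ K) + K))     ≡⟨ cong md (x∙yz≈zx∙y (N ∸ Z) (N ∸ K) K) ⟩
    md (K + (N ∸ Z) + (N ∸ K))       ≡⟨ md-neg-cancel K (N ∸ K) ⟩
    md K                             ≡⟨ md-toℕ k ⟩
    k                                ∎)
    where open ≡-Reasoning; K = toℕ k; Z = toℕ (md (N ∸ K))
  inv-involutive (k , true) = cong (_, true) (begin
    md (toℕ (md (K + n)) + n) ≡⟨ md-+-congʳ n (md-toℕ _) ⟩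
    md (K + n + n)            ≡⟨ cong md (+-assoc K n n) ⟩
    md (K + N)                ≡⟨ md-+N K ⟩
    md K                      ≡⟨ md-toℕ k ⟩
    k                         ∎)
    where open ≡-Reasoning; K = toℕ k

  parity-N : parity N ≡ 0ℙ
  parity-N = trans (ℙ.+-homo-+ n n) (ℙ.p+p≡0ℙ (parity n))

  parity-*N : ∀ m → parity (m * N) ≡ 0ℙ
  parity-*N m = trans (ℙ.*-homo-* m N) (trans (cong (parity m ℙ.*_) parity-N) (ℙ.*-zeroʳ (parity m)))

  parity-md : ∀ x → parity (toℕ (md x)) ≡ parity x
  parity-md x = begin
    parity (toℕ (md x))                 ≡⟨ cong parity (toℕ-md x) ⟩
    parity (x % N)                      ≡⟨ ℙ.+-identityʳ _ ⟨
    parity (x % N) ℙ.+ 0ℙ               ≡⟨ cong (parity (x % N) ℙ.+_) (parity-*N (x / N)) ⟨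
    parity (x % N) ℙ.+ parity (x / N * N) ≡⟨ ℙ.+-homo-+ (x % N) (x / N * N) ⟨
    parity (x % N + x / N * N)          ≡⟨ cong parity (m≡m%n+[m/n]*n x N) ⟨
    parity x                            ∎
    where open ≡-Reasoning

  parity-∸ : ∀ {y} → y ≤ N → parity (N ∸ y) ≡ parity y
  parity-∸ {y} y≤N = ℙ.+-cancelʳ-≡ (parity y) _ _ (begin
    parity (N ∸ y) ℙ.+ parity y ≡⟨ ℙ.+-homo-+ (N ∸ y) y ⟨
    parity (N ∸ y + y)          ≡⟨ cong parity (m∸n+n≡m y≤N) ⟩
    parity N                    ≡⟨ parity-N ⟩
    0ℙ                          ≡⟨ ℙ.p+p≡0ℙ (parity y) ⟨
    parity y ℙ.+ parity y       ∎)
    where open ≡-Reasoning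

module DicyclicQuotient (n : ℕ) .{{_ : NonZero n}} (2∣n : 2 ∣ n) where

  open Dicyclic n
  open DicyclicProperties n

  parity-n : parity n ≡ 0ℙ
  parity-n = even⇒parity≡0ℙ 2∣n

  -- (k , β) stands for a^k b^β, so this is the coset of x modulo ⟨a²⟩.
  coset : Dic → Klein
  coset (k , β) = parity (toℕ k) , β

  coset-homo : ∀ x y → coset (x · y) ≡ coset x ⊕ coset y
  coset-homo (k , false) (m , j) = cong (_, j) (trans (parity-md _) (ℙ.+-homo-+ (toℕ k) (toℕ m)))
  coset-homo (k , true) (m , false) = cong (_, true) (begin
    parity (toℕ (md (K + (N ∸ M))))  ≡⟨ parity-md _ ⟩
    parity (K + (N ∸ M))             ≡⟨ ℙ.+-homo-+ K (N ∸ M) ⟩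
    parity K ℙ.+ parity (N ∸ M)      ≡⟨ cong (parity K ℙ.+_) (parity-∸ (<⇒≤ (Fin.toℕ<n m))) ⟩
    parity K ℙ.+ parity M            ∎)
    where open ≡-Reasoning; K = toℕ k; M = toℕ m
  coset-homo (k , true) (m , true) = cong (_, false) (begin
    parity (toℕ (md (K + (N ∸ M) + n)))   ≡⟨ parity-md _ ⟩
    parity (K + (N ∸ M) + n)              ≡⟨ ℙ.+-homo-+ (K + (N ∸ M)) n ⟩
    parity (K + (N ∸ M)) ℙ.+ parity n     ≡⟨ cong (parity (K + (N ∸ M)) ℙ.+_) parity-n ⟩
    parity (K + (N ∸ M)) ℙ.+ 0ℙ           ≡⟨ ℙ.+-identityʳ _ ⟩
    parity (K + (N ∸ M))                  ≡⟨ ℙ.+-homo-+ K (N ∸ M) ⟩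
    parity K ℙ.+ parity (N ∸ M)           ≡⟨ cong (parity K ℙ.+_) (parity-∸ (<⇒≤ (Fin.toℕ<n m))) ⟩
    parity K ℙ.+ parity M                 ∎)
    where open ≡-Reasoning; K = toℕ k; M = toℕ m

  coset-inv : ∀ x → coset (inv x) ≡ coset x
  coset-inv (k , false) = cong (_, false) (trans (parity-md _) (parity-∸ (<⇒≤ (Fin.toℕ<n k))))
  coset-inv (k , true) = cong (_, true) (begin
    parity (toℕ (md (K + n)))  ≡⟨ parity-md _ ⟩
    parity (K + n)             ≡⟨ ℙ.+-homo-+ K n ⟩
    parity K ℙ.+ parity n      ≡⟨ cong (parity K ℙ.+_) parity-n ⟩
    parity K ℙ.+ 0ℙ            ≡⟨ ℙ.+-identityʳ _ ⟩
    parity K                   ∎)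
    where open ≡-Reasoning; K = toℕ k

  coset-e : coset e ≡ 0ᴷ
  coset-e = cong (_, false) (parity-md 0)

  coset-step : ∀ {x} s → coset x ≡ 0ᴷ → coset (x · s) ≡ coset s
  coset-step {x} s hx = trans (coset-homo x s) (cong (_⊕ coset s) hx)

  coset-square : ∀ x s → coset (x · s · s) ≡ coset x
  coset-square x s = begin
    coset (x · s · s)           ≡⟨ coset-homo (x · s) s ⟩
    coset (x · s) ⊕ coset s     ≡⟨ cong (_⊕ coset s) (coset-homo x s) ⟩
    coset x ⊕ coset s ⊕ coset s ≡⟨ ⊕-cancelʳ (coset x) (coset s) ⟩
    coset x                     ∎
    where open ≡-Reasoning

  generators : List Dic
  generators = a ∷ b ∷ c ∷ []

  moves-pair : ∀ {s} → s ∈ moves → ∃[ g ] g ∈ generators × (s ≡ g ⊎ s ≡ inv g)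
  moves-pair s∈ with ∈-++⁻ generators s∈
  ... | inj₁ g∈    = _ , g∈ , inj₁ refl
  ... | inj₂ s∈inv with ∈-map⁻ inv s∈inv
  ...   | g , g∈ , refl = g , g∈ , inj₂ refl

  coset-pair : ∀ {s g} → s ≡ g ⊎ s ≡ inv g → coset s ≡ coset g
  coset-pair (inj₁ refl) = refl
  coset-pair (inj₂ refl) = coset-inv _

  coset-generator≢0ᴷ : ∀ {g} → g ∈ generators → coset g ≢ 0ᴷ
  coset-generator≢0ᴷ (here refl) eq with trans (sym (parity-md 1)) (cong proj₁ eq)
  ... | ()
  coset-generator≢0ᴷ (there (here refl)) ()
  coset-generator≢0ᴷ (there (there (here refl))) ()

  coset-generator-injective : ∀ {g g′} → g ∈ generators → g′ ∈ generators → coset g ≡ coset g′ → g ≡ g′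
  coset-generator-injective (here refl)                 (here refl)                 _ = refl
  coset-generator-injective (there (here refl))         (there (here refl))         _ = refl
  coset-generator-injective (there (there (here refl))) (there (there (here refl))) _ = refl
  coset-generator-injective (here refl)                 (there (here refl))         ()
  coset-generator-injective (here refl)                 (there (there (here refl))) ()
  coset-generator-injective (there (here refl))         (here refl)                 ()
  coset-generator-injective (there (there (here refl))) (here refl)                 ()
  coset-generator-injective (there (here refl))         (there (there (here refl))) eq
    with trans (sym (parity-md 0)) (trans (cong proj₁ eq) (parity-md 1))
  ... | ()
  coset-generator-injective (there (there (here refl))) (there (here refl))         eq
    with trans (sym (parity-md 1)) (trans (cong proj₁ eq) (parity-md 0))
  ... | ()

  coset-move≢0ᴷ : ∀ {s} → s ∈ moves → coset s ≢ 0ᴷ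
  coset-move≢0ᴷ s∈ with moves-pair s∈
  ... | g , g∈ , s≡ = λ eq → coset-generator≢0ᴷ g∈ (trans (sym (coset-pair s≡)) eq)

  moves-same-coset : ∀ {s u} → s ∈ moves → u ∈ moves → coset s ≡ coset u → u ≡ s ⊎ u ≡ inv s
  moves-same-coset s∈ u∈ eq with moves-pair s∈ | moves-pair u∈
  ... | g , g∈ , s≡ | g′ , g′∈ , u≡
    with coset-generator-injective g∈ g′∈ (trans (sym (coset-pair s≡)) (trans eq (coset-pair u≡)))
  moves-same-coset _ _ _ | g , _ , inj₁ refl | _ , _ , inj₁ refl | refl = inj₁ refl
  moves-same-coset _ _ _ | g , _ , inj₁ refl | _ , _ , inj₂ refl | refl = inj₂ refl
  moves-same-coset _ _ _ | g , _ , inj₂ refl | _ , _ , inj₁ refl | refl = inj₂ (sym (inv-involutive g))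
  moves-same-coset _ _ _ | g , _ , inj₂ refl | _ , _ , inj₂ refl | refl = inj₁ refl

  Home : Dic → Set
  Home x = coset x ≡ 0ᴷ

  home-closed : ∀ {x s} → Home x → s ∈ moves → Home (x · s · s)
  home-closed {x} {s} hx _ = trans (coset-square x s) hx

  home-apart : ∀ {x y u} → Home x → Home y → u ∈ moves → x · u ≢ y
  home-apart {u = u} hx hy u∈ eq =
    coset-move≢0ᴷ u∈ (trans (sym (coset-step u hx)) (trans (cong coset eq) hy))

  home-neighbours : ∀ {x y s u} → Home x → Home y → s ∈ moves → u ∈ moves →
                    x · s ≡ y · u → y ≡ x ⊎ (y ≡ x · s · s × u ≡ inv s)
  home-neighbours {x} {y} {s} {u} hx hy s∈ u∈ eq
    with moves-same-coset s∈ u∈ (trans (sym (coset-step s hx)) (trans (cong coset eq) (coset-step u hy)))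
  ... | inj₁ refl = inj₁ (sym (·-cancelʳ s x y eq))
  ... | inj₂ refl =
    inj₂ (·-cancelʳ (inv s) y (x · s · s) (trans (sym eq) (sym (·-inverseʳ (x · s) s))) , refl)

  module _ (2≤n : 2 ≤ n) where

    4≤N : 4 ≤ N
    4≤N = +-mono-≤ 2≤n 2≤n

    1<N : 1 < N
    1<N = ≤-trans (s≤s (s≤s z≤n)) 4≤N

    n<N : n < N
    n<N = m<m+n n (≤-trans (s≤s z≤n) 2≤n)

    toℕ-md-1 : toℕ (md 1) ≡ 1
    toℕ-md-1 = trans (toℕ-md 1) (m<n⇒m%n≡m 1<N)

    generator≢inv : ∀ {g} → g ∈ generators → g ≢ inv g
    generator≢inv (here refl) eq = <⇒≢ (≤-trans (s≤s (s≤s (s≤s z≤n))) 4≤N) (sym N≡2)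
      where
        1≡N∸1 : 1 ≡ N ∸ 1
        1≡N∸1 = md-injective 1<N (∸-monoʳ-< (s≤s z≤n) (<⇒≤ 1<N))
                  (trans (cong proj₁ eq) (cong (λ t → md (N ∸ t)) toℕ-md-1))
        N≡2 : N ≡ 2
        N≡2 = trans (sym (m∸n+n≡m (<⇒≤ 1<N))) (cong (_+ 1) (sym 1≡N∸1))
    generator≢inv (there (here refl)) eq = ≢-nonZero⁻¹ n (sym 0≡n)
      where
        0≡n : 0 ≡ n
        0≡n = md-injective (<⇒≤ 1<N) n<N (trans (cong proj₁ eq) (md-+-congʳ n (md-toℕ (md 0))))
    generator≢inv (there (there (here refl))) eq = ≢-nonZero⁻¹ n (sym (suc-injective 1≡1+n))
      where
        1≡1+n : 1 ≡ 1 + n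
        1≡1+n = md-injective 1<N (+-monoˡ-< n 2≤n) (trans (cong proj₁ eq) (md-+-congʳ n (md-toℕ (md 1))))

    move≢inv : ∀ {s} → s ∈ moves → s ≢ inv s
    move≢inv s∈ with moves-pair s∈
    ... | g , g∈ , inj₁ refl = generator≢inv g∈
    ... | g , g∈ , inj₂ refl = λ eq → generator≢inv g∈ (sym (trans eq (inv-involutive g)))

    player2-wins : Player2Wins e
    player2-wins = RepeatingStrategy.player2-wins _·_ inv moves _≟_ elements ∈-elements
                     Home home-closed home-apart home-neighbours move≢inv coset-e

theorem4p6 : (n : ℕ) (2≤n : 2 ≤ n) → 2 ∣ n →
    Dicyclic.Player2Wins n {{>-nonZero (≤-trans (s≤s z≤n) 2≤n)}} (Dicyclic.e n {{>-nonZero (≤-trans (s≤s z≤n) 2≤n)}})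
theorem4p6 n 2≤n 2∣n = DicyclicQuotient.player2-wins n {{>-nonZero (≤-trans (s≤s z≤n) 2≤n)}} 2∣n 2≤n
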